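{- For every hypergraph $H$, $|V(H)|-b_L(H)=|V(H^*)|-b_L(H^*)$; equivalently $b_L(H^*)=|E(H)|-|V(H)|+b_L(H)$.
   Context: A hypergraph $H$ consists of a finite vertex set $V(H)$ and a finite collection $E(H)$ of subsets of $V(H)$ (hyperedges; repeated hyperedges are allowed). Lazy burning on $H$: a set $B\subseteq V(H)$ is burned initially; in each subsequent round, every unburned vertex $v$ for which there is a hyperedge $h\ni v$ with $h\setminus\{v\}$ entirely burned becomes burned. $B$ is a lazy burning set if eventually all vertices burn; $b_L(H)$ is the minimum size of a lazy burning set. The dual hypergraph $H^*$ has vertex set $E(H)$ and hyperedges $N(v)=\{h\in E(H): v\in h\}$ for each $v\in V(H)$. -}

module Defs where

open import Data.Nat using (ℕ; zero; suc; _≤_)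
open import Data.Fin using (Fin)
open import Data.Fin.Subset using (Subset; _∈_; ∣_∣)
open import Data.Vec using (lookup; tabulate)
open import Data.Product using (Σ; _×_)
open import Data.Sum using (_⊎_)
open import Relation.Binary.PropositionalEquality using (_≡_; _≢_)

-- A hypergraph with vertex set Fin n and m hyperedges, indexed by Fin m
-- (so repeated hyperedges are allowed); hyperedge j is the subset H j.
Hypergraph : ℕ → ℕ → Set
Hypergraph n m = Fin m → Subset n

dual : ∀ {n m} → Hypergraph n m → Hypergraph m n
dual H v = tabulate (λ j → lookup (H j) v)

burned : ∀ {n m} → Hypergraph n m → Subset n → ℕ → Fin n → Set
burned H B zero v = v ∈ B
burned {n} {m} H B (suc k) v =
  burned H B k v ⊎
  Σ (Fin m) (λ j → v ∈ H j × ((u : Fin n) → u ∈ H j → u ≢ v → burned H B k u))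

IsLazyBurningSet : ∀ {n m} → Hypergraph n m → Subset n → Set
IsLazyBurningSet {n} H B = Σ ℕ (λ k → (v : Fin n) → burned H B k v)

IsLazyBurningNumber : ∀ {n m} → Hypergraph n m → ℕ → Set
IsLazyBurningNumber {n} H b =
  Σ (Subset n) (λ B → IsLazyBurningSet H B × ∣ B ∣ ≡ b) ×
  ((B : Subset n) → IsLazyBurningSet H B → b ≤ ∣ B ∣)

{-# OPTIONS --safe #-}
module Submission where

-- Burn H from a lazy burning set B and let every vertex v ∉ B pick a hyperedge that
-- ignited it: one whose other vertices all burned strictly before v.  Two vertices never
-- pick the same hyperedge, so at least |V| − |B| hyperedges are picked.  The unpicked
-- hyperedges form a lazy burning set of the dual: running time backwards, the hyperedge
-- picked by v is ignited by N(v), because every other hyperedge containing v is unpicked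
-- or was picked by a vertex that burned after v.  Hence b_L(H*) ≤ |E| − |V| + b_L(H), and
-- the same argument applied to H*, whose dual is H, gives the reverse inequality.

open import Defs
open import Data.Nat using (ℕ; zero; suc; _+_; _∸_; _≤_; _<_; z≤n; s≤s; _≤′_; ≤′-reflexive; ≤′-step)
open import Data.Nat.Properties
  using (≤-antisym; ≤⇒≤′; ≰⇒>; 1+n≰n; <-asym; ∸-monoʳ-<; m∸n≤m; m∸n+n≡m; +-comm; +-assoc; +-monoˡ-≤; +-monoʳ-≤; module ≤-Reasoning)
open import Data.Bool using (Bool; true; false)
open import Data.Bool.Properties using (T-≡)
open import Data.Fin using (Fin; zero; suc)
open import Data.Fin.Properties using (suc-injective; any?; all?) renaming (_≟_ to _≟ᶠ_)
open import Data.Fin.Subset using (Subset; _∈_; _∉_; ∣_∣; ∁; _-_)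
open import Data.Fin.Subset.Properties
  using (_∈?_; ∣p∣≤n; ∣∁p∣≡n∸∣p∣; x∈p⇒∣p-x∣<∣p∣; x∈p∧x∉q⇒x∈p─q; x≢y⇒x∉⁅y⁆; x∈∁p⇒x∉p; x∉p⇒x∈∁p)
open import Data.Vec using ([]; _∷_; lookup; tabulate; here; there)
open import Data.Vec.Properties using (lookup∘tabulate; []=⇒lookup; lookup⇒[]=)
open import Data.Product using (Σ; ∃; _×_; _,_; proj₁; proj₂)
open import Data.Sum using (inj₁; inj₂)
open import Function using (_∘_)
open import Function.Bundles using (_⇔_; mk⇔; Equivalence)
open import Relation.Nullary using (Dec; yes; no; ¬?; contradiction)
open import Relation.Nullary.Decidable using (_×-dec_; _⊎-dec_; _→-dec_; isYes; toWitness; fromWitness)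
open import Relation.Unary using (Pred; Decidable)
open import Relation.Binary.PropositionalEquality using (_≡_; _≢_; refl; sym; trans; cong; subst)

open Equivalence using (to; from)

∈-tabulate : ∀ {n} (f : Fin n → Bool) (x : Fin n) → x ∈ tabulate f ⇔ f x ≡ true
∈-tabulate f x = mk⇔
  (λ x∈ → trans (sym (lookup∘tabulate f x)) ([]=⇒lookup x∈))
  (λ fx → lookup⇒[]= x (tabulate f) (trans (lookup∘tabulate f x) fx))

toSubset : ∀ {n ℓ} {P : Pred (Fin n) ℓ} → Decidable P → Subset n
toSubset P? = tabulate (isYes ∘ P?)

∈-toSubset : ∀ {n ℓ} {P : Pred (Fin n) ℓ} (P? : Decidable P) {x : Fin n} → x ∈ toSubset P? ⇔ P x
∈-toSubset P? {x} = mk⇔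
  (λ x∈ → toWitness (from T-≡ (to (∈-tabulate (isYes ∘ P?) x) x∈)))
  (λ px → from (∈-tabulate (isYes ∘ P?) x) (to T-≡ (fromWitness px)))

∣∁p∣+∣p∣≡n : ∀ {n} (p : Subset n) → ∣ ∁ p ∣ + ∣ p ∣ ≡ n
∣∁p∣+∣p∣≡n p = trans (cong (_+ ∣ p ∣) (∣∁p∣≡n∸∣p∣ p)) (m∸n+n≡m (∣p∣≤n p))

injection⇒∣p∣≤∣q∣ : ∀ {n m} (p : Subset n) (q : Subset m) (f : ∀ x → x ∈ p → Fin m) →
  (∀ x x∈p → f x x∈p ∈ q) →
  (∀ x y x∈p y∈p → f x x∈p ≡ f y y∈p → x ≡ y) →
  ∣ p ∣ ≤ ∣ q ∣
injection⇒∣p∣≤∣q∣ [] q f f∈q f-inj = z≤n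
injection⇒∣p∣≤∣q∣ (false ∷ p) q f f∈q f-inj =
  injection⇒∣p∣≤∣q∣ p q (λ x → f (suc x) ∘ there) (λ x → f∈q (suc x) ∘ there)
    (λ x y x∈p y∈p → suc-injective ∘ f-inj (suc x) (suc y) (there x∈p) (there y∈p))
injection⇒∣p∣≤∣q∣ (true ∷ p) q f f∈q f-inj = begin
  suc ∣ p ∣               ≤⟨ s≤s (injection⇒∣p∣≤∣q∣ p (q - f zero here) f′ f′∈q-f₀ f′-inj) ⟩
  suc ∣ q - f zero here ∣ ≤⟨ x∈p⇒∣p-x∣<∣p∣ (f∈q zero here) ⟩
  ∣ q ∣                   ∎
  where
  open ≤-Reasoning
  f′ : ∀ x → x ∈ p → Fin _
  f′ x = f (suc x) ∘ there
  f′∈q-f₀ : ∀ x x∈p → f′ x x∈p ∈ q - f zero here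
  f′∈q-f₀ x x∈p = x∈p∧x∉q⇒x∈p─q (f∈q (suc x) (there x∈p))
    (x≢y⇒x∉⁅y⁆ λ f′x≡f₀ → contradiction (f-inj (suc x) zero (there x∈p) here f′x≡f₀) λ ())
  f′-inj : ∀ x y x∈p y∈p → f′ x x∈p ≡ f′ y y∈p → x ≡ y
  f′-inj x y x∈p y∈p = suc-injective ∘ f-inj (suc x) (suc y) (there x∈p) (there y∈p)

least-monotone : ∀ {ℓ} {P : Pred ℕ ℓ} → Decidable P → (∀ {i j} → i ≤ j → P i → P j) →
  ∀ {k} → P k → Σ ℕ λ t → P t × (∀ {i} → P i → t ≤ i)
least-monotone P? mono {zero} p = zero , p , λ _ → z≤n
least-monotone P? mono {suc k} p with P? k
... | yes pk = least-monotone P? mono pk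
... | no ¬pk = suc k , p , λ pi → ≰⇒> λ i≤k → ¬pk (mono i≤k pi)

-- Duality up to incidence, so that it is symmetric: dual (dual H) is not H definitionally.
IsDual : ∀ {n m} → Hypergraph n m → Hypergraph m n → Set
IsDual {n} {m} H H′ = (v : Fin n) (e : Fin m) → v ∈ H e ⇔ e ∈ H′ v

dual-isDual : ∀ {n m} (H : Hypergraph n m) → IsDual H (dual H)
dual-isDual H v e = mk⇔
  (λ v∈e → from (∈-tabulate (λ e → lookup (H e) v) e) ([]=⇒lookup v∈e))
  (λ e∋v → lookup⇒[]= v (H e) (to (∈-tabulate (λ e → lookup (H e) v) e) e∋v))

isDual-sym : ∀ {n m} {H : Hypergraph n m} {H′ : Hypergraph m n} → IsDual H H′ → IsDual H′ H
isDual-sym H≈H′ e v = mk⇔ (from (H≈H′ v e)) (to (H≈H′ v e))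

module _ {n m} (H : Hypergraph n m) (B : Subset n) where

  burned-mono : ∀ {i j v} → i ≤ j → burned H B i v → burned H B j v
  burned-mono = go ∘ ≤⇒≤′
    where
    go : ∀ {i j v} → i ≤′ j → burned H B i v → burned H B j v
    go (≤′-reflexive refl) b = b
    go (≤′-step i≤′j)      b = inj₁ (go i≤′j b)

  burned? : ∀ k → Decidable (burned H B k)
  burned? zero    v = v ∈? B
  burned? (suc k) v = burned? k v ⊎-dec
    any? λ e → (v ∈? H e) ×-dec all? λ u → (u ∈? H e) →-dec ¬? (u ≟ᶠ v) →-dec burned? k u

module BurningOrder {n m} (H : Hypergraph n m) (B : Subset n) (k : ℕ) (all-burned : ∀ v → burned H B k v) where

  private
    first-burning : ∀ v → Σ ℕ λ t → burned H B t v × (∀ {i} → burned H B i v → t ≤ i)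
    first-burning v = least-monotone (λ i → burned? H B i v) (burned-mono H B) (all-burned v)

  time : Fin n → ℕ
  time v = proj₁ (first-burning v)

  burned-at-time : ∀ v → burned H B (time v) v
  burned-at-time v = proj₁ (proj₂ (first-burning v))

  time-minimal : ∀ {i v} → burned H B i v → time v ≤ i
  time-minimal {v = v} = proj₂ (proj₂ (first-burning v))

  Ignites : Fin m → Fin n → Set
  Ignites e v = v ∈ H e × (∀ u → u ∈ H e → u ≢ v → time u < time v)

  ignition : ∀ v → v ∉ B → ∃ λ e → Ignites e v
  ignition v = first-step (burned-at-time v) (time-minimal {v = v})
    where
    first-step : ∀ {s} → burned H B s v → (∀ {i} → burned H B i v → s ≤ i) → v ∉ B →
      ∃ λ e → v ∈ H e × (∀ u → u ∈ H e → u ≢ v → time u < s)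
    first-step {zero}  v∈B                      _       v∉B = contradiction v∈B v∉B
    first-step {suc s} (inj₁ burned-earlier)    minimal _   = contradiction (minimal burned-earlier) 1+n≰n
    first-step {suc s} (inj₂ (e , v∈e , rest)) _       _   =
      e , v∈e , λ u u∈e u≢v → s≤s (time-minimal (rest u u∈e u≢v))

  igniter : ∀ v → v ∉ B → Fin m
  igniter v v∉B = proj₁ (ignition v v∉B)

  igniter-ignites : ∀ v v∉B → Ignites (igniter v v∉B) v
  igniter-ignites v v∉B = proj₂ (ignition v v∉B)

  igniter-injective : ∀ {v w} v∉B w∉B → igniter v v∉B ≡ igniter w w∉B → v ≡ w
  igniter-injective {v} {w} v∉B w∉B same with v ≟ᶠ w
  ... | yes v≡w = v≡w
  ... | no  v≢w = contradiction w-before-v (<-asym v-before-w)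
    where
    v-before-w : time v < time w
    v-before-w = proj₂ (igniter-ignites w w∉B) v
      (subst (λ e → v ∈ H e) same (proj₁ (igniter-ignites v v∉B))) v≢w
    w-before-v : time w < time v
    w-before-v = proj₂ (igniter-ignites v v∉B) w
      (subst (λ e → w ∈ H e) (sym same) (proj₁ (igniter-ignites w w∉B))) (v≢w ∘ sym)

  IsIgniter : Fin m → Set
  IsIgniter e = ∃ λ v → Σ (v ∉ B) λ v∉B → igniter v v∉B ≡ e

  isIgniter? : Decidable IsIgniter
  isIgniter? e = any? λ v → igniter-of? v (v ∈? B)
    where
    igniter-of? : ∀ v → Dec (v ∈ B) → Dec (Σ (v ∉ B) λ v∉B → igniter v v∉B ≡ e)
    igniter-of? v (yes v∈B) = no λ (v∉B , _) → v∉B v∈B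
    igniter-of? v (no v∉B) with igniter v v∉B ≟ᶠ e
    ... | yes ≡e = yes (v∉B , ≡e)
    ... | no  ≢e = no (≢e ∘ proj₂)

  Igniters : Subset m
  Igniters = toSubset isIgniter?

  ∣∁B∣≤∣Igniters∣ : ∣ ∁ B ∣ ≤ ∣ Igniters ∣
  ∣∁B∣≤∣Igniters∣ = injection⇒∣p∣≤∣q∣ (∁ B) Igniters
    (λ v → igniter v ∘ x∈∁p⇒x∉p)
    (λ v v∈∁B → from (∈-toSubset isIgniter?) (v , x∈∁p⇒x∉p v∈∁B , refl))
    (λ v w v∈∁B w∈∁B → igniter-injective (x∈∁p⇒x∉p v∈∁B) (x∈∁p⇒x∉p w∈∁B))

  time≤k : ∀ v → time v ≤ k
  time≤k v = time-minimal (all-burned v)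

  module _ {H′ : Hypergraph m n} (H≈H′ : IsDual H H′) where

    mutual
      igniter-burned : ∀ d v v∉B → k ∸ time v ≤ d → burned H′ (∁ Igniters) (suc d) (igniter v v∉B)
      igniter-burned d v v∉B k∸time≤d =
        inj₂ (v , to (H≈H′ v _) (proj₁ (igniter-ignites v v∉B)) , others-burned)
        where
        others-burned : ∀ e → e ∈ H′ v → e ≢ igniter v v∉B → burned H′ (∁ Igniters) d e
        others-burned e e∋v e≢ with e ∈? Igniters
        ... | no e∉ = burned-mono H′ (∁ Igniters) z≤n (x∉p⇒x∈∁p e∉)
        ... | yes e∈ with to (∈-toSubset isIgniter?) e∈
        ...   | w , w∉B , refl = igniter-burned-before w w∉B (begin-strict
          k ∸ time w  <⟨ ∸-monoʳ-< v-before-w (time≤k w) ⟩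
          k ∸ time v  ≤⟨ k∸time≤d ⟩
          d           ∎)
          where
          open ≤-Reasoning
          -- ⊥ is definitionally proof-irrelevant, so igniter v w∉B and igniter v v∉B coincide.
          v-before-w : time v < time w
          v-before-w = proj₂ (igniter-ignites w w∉B) v (from (H≈H′ v e) e∋v) λ { refl → e≢ refl }

      igniter-burned-before : ∀ {d} w w∉B → k ∸ time w < d → burned H′ (∁ Igniters) d (igniter w w∉B)
      igniter-burned-before {suc d} w w∉B (s≤s k∸time≤d) = igniter-burned d w w∉B k∸time≤d

    ∁Igniters-isLazyBurningSet : IsLazyBurningSet H′ (∁ Igniters)
    ∁Igniters-isLazyBurningSet = suc k , all-burned′
      where
      all-burned′ : ∀ e → burned H′ (∁ Igniters) (suc k) e
      all-burned′ e with e ∈? Igniters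
      ... | no e∉ = burned-mono H′ (∁ Igniters) z≤n (x∉p⇒x∈∁p e∉)
      ... | yes e∈ with to (∈-toSubset isIgniter?) e∈
      ...   | w , w∉B , refl = igniter-burned k w w∉B (m∸n≤m k (time w))

  ∣∁Igniters∣+n≤m+∣B∣ : ∣ ∁ Igniters ∣ + n ≤ m + ∣ B ∣
  ∣∁Igniters∣+n≤m+∣B∣ = begin
    ∣ ∁ Igniters ∣ + n                          ≡⟨ cong (∣ ∁ Igniters ∣ +_) (sym (∣∁p∣+∣p∣≡n B)) ⟩
    ∣ ∁ Igniters ∣ + (∣ ∁ B ∣ + ∣ B ∣)          ≤⟨ +-monoʳ-≤ ∣ ∁ Igniters ∣ (+-monoˡ-≤ ∣ B ∣ ∣∁B∣≤∣Igniters∣) ⟩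
    ∣ ∁ Igniters ∣ + (∣ Igniters ∣ + ∣ B ∣)     ≡⟨ sym (+-assoc (∣ ∁ Igniters ∣) (∣ Igniters ∣) (∣ B ∣)) ⟩
    ∣ ∁ Igniters ∣ + ∣ Igniters ∣ + ∣ B ∣       ≡⟨ cong (_+ ∣ B ∣) (∣∁p∣+∣p∣≡n Igniters) ⟩
    m + ∣ B ∣                                   ∎
    where open ≤-Reasoning

isDual⇒lazyBurningSet : ∀ {n m} {H : Hypergraph n m} {H′ : Hypergraph m n} → IsDual H H′ →
  ∀ {B} → IsLazyBurningSet H B → ∃ λ B′ → IsLazyBurningSet H′ B′ × ∣ B′ ∣ + n ≤ m + ∣ B ∣
isDual⇒lazyBurningSet {H = H} H≈H′ {B} (k , all-burned) =
  ∁ Igniters , ∁Igniters-isLazyBurningSet H≈H′ , ∣∁Igniters∣+n≤m+∣B∣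
  where open BurningOrder H B k all-burned

isDual⇒lazyBurningNumber-≤ : ∀ {n m} {H : Hypergraph n m} {H′ : Hypergraph m n} → IsDual H H′ →
  ∀ {b b′} → IsLazyBurningNumber H b → IsLazyBurningNumber H′ b′ → n + b′ ≤ m + b
isDual⇒lazyBurningNumber-≤ {n} {m} H≈H′ {b} {b′} ((B , B-burns , ∣B∣≡b) , _) (_ , b′-minimal)
  with B′ , B′-burns , ∣B′∣+n≤m+∣B∣ ← isDual⇒lazyBurningSet H≈H′ B-burns = begin
    n + b′      ≤⟨ +-monoʳ-≤ n (b′-minimal B′ B′-burns) ⟩
    n + ∣ B′ ∣  ≡⟨ +-comm n ∣ B′ ∣ ⟩
    ∣ B′ ∣ + n  ≤⟨ ∣B′∣+n≤m+∣B∣ ⟩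
    m + ∣ B ∣   ≡⟨ cong (m +_) ∣B∣≡b ⟩
    m + b       ∎
    where open ≤-Reasoning

corollary2p6 : (n m : ℕ) (H : Hypergraph n m) (b b* : ℕ) →
    IsLazyBurningNumber H b → IsLazyBurningNumber (dual H) b* →
    n + b* ≡ m + b
corollary2p6 n m H b b* b-is-bL b*-is-bL* = ≤-antisym
  (isDual⇒lazyBurningNumber-≤ (dual-isDual H) b-is-bL b*-is-bL*)
  (isDual⇒lazyBurningNumber-≤ (isDual-sym (dual-isDual H)) b*-is-bL* b-is-bL)
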